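{- Let $D>0$ and $A\ge 2D$ be reals. Let $n$ be a positive integer with standard binary expansion $N_{\mathcal B}=n_\lambda\dots n_0$, $n_\lambda=1$, and let $N^*=n^*_{\lambda+1}\dots n^*_0$ be the output of Algorithm 2 on $N_{\mathcal B}$. Then $N^*$ is a canonical representation of $n$, and $T(N^*,\lambda+1)\le T(M,\lambda+1)$ for every canonical representation $M=m_{\lambda+1}\dots m_0$ of $n$.
   Context: A canonical representation of $n$ is a string $m_\mu\dots m_0$ with $m_i\in\{ -1,0,1\}$ and $\sum_i m_i2^i=n$; $\bar1$ denotes $-1$. Strings are written most significant digit first. In patterns, $x^k$ is $k$ repetitions, $x^*$ is zero or more repetitions, and "ends with a pattern" means a suffix matches it. Time model: for a digit string $N=n_\lambda\dots n_0$, define recursively for $0\le i\le\lambda$: $T(N,i)=0$ if $i=0$ and $n_0=0$; $T(N,i)=T(N,i-1)$ if $i>0$ and $n_i=0$; $T(N,i)=iD+(|n_i|-1)A$ if $n_i\ne0$ and $n_j=0$ for all $0\le j<i$; and $T(N,i)=\max(T(N,i-1),iD)+|n_i|A$ otherwise. toNAF$(N,i)$: input a digit string $N=n_\lambda\dots n_0$ and a starting index $i$. Set $n'_j\leftarrow n_j$ for $j\le\lambda$, $n'_{\lambda+1}\leftarrow0$. While $i<\lambda$: if $n'_i=1$ and $n'_{i+1}=1$, set $n'_i\leftarrow-1$, $i\leftarrow i+1$; while $n'_i=1$ set $n'_i\leftarrow0$, $i\leftarrow i+1$; then set $n'_i\leftarrow1$ (continue the outer loop without incrementing $i$). Otherwise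 $i\leftarrow i+1$. Return $n'_{\lambda+1}\dots n'_0$. Algorithm 2: input $N_{\mathcal B}=n_\lambda\dots n_0$. Let $\ell$ be the index of the least significant $1$. The pattern tests are applied to the string $00n_\lambda\dots n_0$. If it ends with $11(01)^*010^*$: set $n_\ell\leftarrow-1$, $n_{\ell+1}\leftarrow1$ and return toNAF$(N_{\mathcal B},\ell+1)$. Else if it ends with $0(01)^*0110^*$: return toNAF$(N_{\mathcal B},\ell+1)$. Else return toNAF$(N_{\mathcal B},\ell)$.
   Formalization: The parameters D and A of the time model range over the rationals instead of the reals. -}

module Defs where

open import Data.Bool using (Bool; true; false; if_then_else_; _∧_)
open import Data.Nat as ℕ using (ℕ; zero; suc; _<ᵇ_)
open import Data.Integer as ℤ using (ℤ; +_; -[1+_])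
open import Data.Rational as ℚ using (ℚ; 0ℚ; 1ℚ; _/_)
open import Data.List using (List; []; _∷_)
open import Data.Vec using (Vec; tabulate; toList)
open import Data.Fin using (toℕ)
open import Relation.Binary.PropositionalEquality using (_≡_)

data Digit : Set where
  zer one neg : Digit

dval : Digit → ℤ
dval zer = + 0
dval one = + 1
dval neg = -[1+ 0 ]

absQ : Digit → ℚ
absQ zer = 0ℚ
absQ one = 1ℚ
absQ neg = 1ℚ

isZero isOne : Digit → Bool
isZero zer = true
isZero _   = false
isOne one = true
isOne _   = false

-- Digit strings are stored LEAST significant digit first:
-- the list  d₀ ∷ d₁ ∷ … ∷ d_λ ∷ []  is the string  d_λ … d₁ d₀.

value : List Digit → ℤ
value []       = + 0
value (d ∷ ds) = dval d ℤ.+ (+ 2) ℤ.* value ds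

dig : List Digit → ℕ → Digit
dig []       _       = zer
dig (d ∷ ds) zero    = d
dig (d ∷ ds) (suc i) = dig ds i

lowerZero : List Digit → ℕ → Bool
lowerZero N zero    = true
lowerZero N (suc i) = isZero (dig N i) ∧ lowerZero N i

ℕtoℚ : ℕ → ℚ
ℕtoℚ i = (+ i) / 1

T : (D A : ℚ) → List Digit → ℕ → ℚ
T D A N zero with dig N 0
... | zer = 0ℚ
... | d   = ℕtoℚ 0 ℚ.* D ℚ.+ (absQ d ℚ.- 1ℚ) ℚ.* A
T D A N (suc i) with dig N (suc i)
... | zer = T D A N i
... | d   = if lowerZero N (suc i)
            then ℕtoℚ (suc i) ℚ.* D ℚ.+ (absQ d ℚ.- 1ℚ) ℚ.* A
            else (T D A N i ℚ.⊔ ℕtoℚ (suc i) ℚ.* D) ℚ.+ absQ d ℚ.* A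

Arr : Set
Arr = ℕ → Digit

set : Arr → ℕ → Digit → Arr
set f j d k = if k ℕ.≡ᵇ j then d else f k

record State : Set where
  constructor st
  field arr : Arr
        idx : ℕ

innerLoop : ℕ → State → State
innerLoop zero s = s
innerLoop (suc fuel) (st f i) =
  if isOne (f i) then innerLoop fuel (st (set f i zer) (suc i)) else st f i

outerLoop : ℕ → ℕ → State → Arr
outerLoop λ′ zero (st f i) = f
outerLoop λ′ (suc fuel) (st f i) =
  if i <ᵇ λ′
  then (if isOne (f i) ∧ isOne (f (suc i))
        then (let s  = innerLoop (suc (suc λ′)) (st (set f i neg) (suc i))
                  f′ = set (State.arr s) (State.idx s) one
              in outerLoop λ′ fuel (st f′ (State.idx s)))
        else outerLoop λ′ fuel (st f (suc i)))
  else f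

-- The initial array has n'_{λ+1} = 0 (and 0 beyond).  Fuel λ+1 for the
-- outer loop (i strictly increases) and λ+2 for the inner loop (it stops
-- at the latest at index λ+1) suffices.
toNAF : {λ′ : ℕ} → Vec Digit (suc λ′) → ℕ → Vec Digit (suc (suc λ′))
toNAF {λ′} N i =
  tabulate (λ j → outerLoop λ′ (suc λ′) (st (dig (toList N)) i) (toℕ j))

lowestOne : List Digit → ℕ
lowestOne []        = zero
lowestOne (one ∷ _) = zero
lowestOne (_ ∷ ds)  = suc (lowestOne ds)

-- Pattern tests on the string 00 n_λ … n_0.  Stored LSB first, this is
-- s = n_0 ∷ … ∷ n_λ ∷ 0 ∷ 0 ∷ [], and "the string ends with pattern P"
-- means "a prefix of s matches the reversal of P".
--
-- reversal of 11(01)*010*  is  0* 1 0 (10)* 1 1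
tail₁ : List Digit → Bool
tail₁ (one ∷ one ∷ _) = true
tail₁ (one ∷ zer ∷ s) = tail₁ s
tail₁ _               = false

endsWith₁ : List Digit → Bool
endsWith₁ (zer ∷ s)       = endsWith₁ s
endsWith₁ (one ∷ zer ∷ s) = tail₁ s
endsWith₁ _               = false

-- reversal of 0(01)*0110*  is  0* 1 1 0 (10)* 0
tail₂ : List Digit → Bool
tail₂ (zer ∷ _)       = true
tail₂ (one ∷ zer ∷ s) = tail₂ s
tail₂ _               = false

endsWith₂ : List Digit → Bool
endsWith₂ (zer ∷ s)             = endsWith₂ s
endsWith₂ (one ∷ one ∷ zer ∷ s) = tail₂ s
endsWith₂ _                     = false

setV : {m : ℕ} → Vec Digit m → ℕ → Digit → Vec Digit m
setV {m} N j d = tabulate (λ k → set (dig (toList N)) j d (toℕ k))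

padded : List Digit → List Digit
padded []       = zer ∷ zer ∷ []
padded (d ∷ ds) = d ∷ padded ds

algorithm2 : {λ′ : ℕ} → Vec Digit (suc λ′) → Vec Digit (suc (suc λ′))
algorithm2 N =
  let s = padded (toList N)
      ℓ = lowestOne (toList N)
  in if endsWith₁ s
     then toNAF (setV (setV N ℓ neg) (suc ℓ) one) (suc ℓ)
     else (if endsWith₂ s then toNAF N (suc ℓ) else toNAF N ℓ)

-- M is a canonical representation of n (digits are in {-1,0,1} by type)
IsCanonicalRep : {m : ℕ} → Vec Digit m → ℕ → Set
IsCanonicalRep M n = value (toList M) ≡ + n

data IsBit : Digit → Set where
  bit0 : IsBit zer
  bit1 : IsBit one

-- Write n = 2^ℓ (1 + 2b). A representation of n is 0^ℓ followed by 1 and a representation M of b,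
-- or by 1̄ and a representation M of b + 1, and its time T(·, λ+1) is max(ℓD + wA, P), where w is
-- the number of nonzero digits of M and P the largest pD + (number of nonzero digits at positions
-- ≥ p)·A over the nonzero digits of M, at their positions p. A non-adjacent form beats every other
-- representation of the same number in both w and P. This goes by induction on the other
-- representation: where the lowest digits differ, it continues with a representation of 2v ± 1 one
-- position up while the non-adjacent form continues with one of v two positions up, and two more
-- doublings cost no more than one more addition since A ≥ 2D. Algorithm 2 returns 0^ℓ 1 NAF(b) or
-- 0^ℓ 1̄ NAF(b + 1), and its pattern tests pick the candidate that beats the other.
{-# OPTIONS --safe #-}
module Submission where

open import Defs
open import Data.Nat using (ℕ; suc; _≤_)
open import Data.Integer using (+_)
open import Data.Rational using (ℚ; 0ℚ; _<_; _*_) renaming (_≤_ to _≤ℚ_)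
open import Data.Vec using (Vec; last; toList)
open import Data.Vec.Relation.Unary.All using (All)
open import Data.Product using (_×_)
open import Relation.Binary.PropositionalEquality using (_≡_)

open import Data.Bool using (Bool; true; false; not; _∧_; if_then_else_)
import Data.Bool.Properties as BoolP
open import Data.Empty using (⊥-elim)
open import Data.Fin using (toℕ)
open import Data.Integer as ℤ using (ℤ; -[1+_])
import Data.Integer.Properties as ℤP
open import Data.Integer.Tactic.RingSolver using (solve-∀)
open import Data.List using (List; []; _∷_; _++_; _∷ʳ_; length; replicate; take)
import Data.List.Properties as ListP
import Data.List.Relation.Unary.All as ListAll
open ListAll using ([]; _∷_)
import Data.List.Relation.Unary.All.Properties as ListAllP
open import Data.Nat as ℕ using (zero; z≤n; s≤s; _+_)
import Data.Nat.Coprimality as Coprime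
import Data.Nat.Properties as ℕP
open import Data.Product using (Σ-syntax; _,_)
open import Data.Rational as ℚ using (1ℚ; mkℚ; _⊔_)
import Data.Rational.Properties as ℚP
open import Data.Rational.Solver using (module +-*-Solver)
open import Data.Sum using (_⊎_; inj₁; inj₂; [_,_]′)
open import Data.Vec using (tabulate)
import Data.Vec.Properties as VecP
import Data.Vec.Relation.Unary.All.Properties as VecAllP
open import Relation.Nullary using (yes; no)
open import Relation.Binary.PropositionalEquality
  using (_≢_; _≗_; refl; sym; trans; cong; cong₂; cong-app; subst; subst₂; module ≡-Reasoning)
open import Algebra.Properties.AbelianGroup ℤP.+-0-abelianGroup
  using () renaming (∙-cancelˡ to ℤ+-cancelˡ)

data Nonzero : Digit → Set where
  one≢0 : Nonzero one
  neg≢0 : Nonzero neg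

data Opposite : Digit → Digit → Set where
  one-neg : Opposite one neg
  neg-one : Opposite neg one

nonzero-cases : ∀ {d e} → Nonzero d → Nonzero e → d ≡ e ⊎ Opposite d e
nonzero-cases one≢0 one≢0 = inj₁ refl
nonzero-cases one≢0 neg≢0 = inj₂ one-neg
nonzero-cases neg≢0 one≢0 = inj₂ neg-one
nonzero-cases neg≢0 neg≢0 = inj₁ refl

opposite-nonzeroʳ : ∀ {d e} → Opposite d e → Nonzero e
opposite-nonzeroʳ one-neg = neg≢0
opposite-nonzeroʳ neg-one = one≢0

weight : List Digit → ℕ
weight []        = 0
weight (zer ∷ L) = weight L
weight (_   ∷ L) = suc (weight L)

weight-∷ : ∀ {d} L → Nonzero d → weight (d ∷ L) ≡ suc (weight L)
weight-∷ L one≢0 = refl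
weight-∷ L neg≢0 = refl

weight≤weight-∷ : ∀ d M → weight M ≤ weight (d ∷ M)
weight≤weight-∷ zer M = ℕP.≤-refl
weight≤weight-∷ one M = ℕP.n≤1+n _
weight≤weight-∷ neg M = ℕP.n≤1+n _

weight-∷≢0 : ∀ {d} L → Nonzero d → weight (d ∷ L) ≢ 0
weight-∷≢0 L one≢0 ()
weight-∷≢0 L neg≢0 ()

zeros : ℕ → List Digit
zeros ℓ = replicate ℓ zer

weight-zeros-++ : ∀ ℓ L → weight (zeros ℓ ++ L) ≡ weight L
weight-zeros-++ zero    L = refl
weight-zeros-++ (suc ℓ) L = weight-zeros-++ ℓ L

Bits : List Digit → Set
Bits = ListAll.All IsBit

++-zer-Bits : ∀ {L} → Bits L → Bits (L ++ zer ∷ [])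
++-zer-Bits bL = ListAllP.++⁺ bL (bit0 ∷ [])

1+2a≢2b : ∀ a b → + 1 ℤ.+ + 2 ℤ.* a ≢ + 2 ℤ.* b
1+2a≢2b a b h = 1≢2*n ℤ.∣ b ℤ.- a ∣ (trans (cong ℤ.∣_∣ 1≡2[b-a]) (ℤP.abs-* (+ 2) (b ℤ.- a)))
  where
  1≢2*n : ∀ n → 1 ≢ 2 ℕ.* n
  1≢2*n zero    ()
  1≢2*n (suc n) h = ℕP.0≢1+n (trans (ℕP.suc-injective h) (ℕP.+-suc n (n ℕ.+ 0)))
  cancel-2a : ∀ a → + 1 ≡ (+ 1 ℤ.+ + 2 ℤ.* a) ℤ.- + 2 ℤ.* a
  cancel-2a = solve-∀
  factor-2 : ∀ a b → + 2 ℤ.* b ℤ.- + 2 ℤ.* a ≡ + 2 ℤ.* (b ℤ.- a)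
  factor-2 = solve-∀
  1≡2[b-a] : + 1 ≡ + 2 ℤ.* (b ℤ.- a)
  1≡2[b-a] = trans (cancel-2a a) (trans (cong (ℤ._- + 2 ℤ.* a) h) (factor-2 a b))

c+2*-cancel : ∀ c {x y} → c ℤ.+ + 2 ℤ.* x ≡ c ℤ.+ + 2 ℤ.* y → x ≡ y
c+2*-cancel c {x} {y} h = ℤP.*-cancelˡ-≡ (+ 2) x y (ℤ+-cancelˡ c _ _ h)

1+2[y-1] : ∀ y → + 1 ℤ.+ + 2 ℤ.* (y ℤ.- + 1) ≡ -[1+ 0 ] ℤ.+ + 2 ℤ.* y
1+2[y-1] = solve-∀

data Split (d e : Digit) (x y : ℤ) : Set where
  same     : d ≡ e → x ≡ y → Split d e x y
  opposite : Opposite d e → y ≡ dval d ℤ.+ x → Split d e x y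

split : ∀ d e K M → value (d ∷ K) ≡ value (e ∷ M) → Split d e (value K) (value M)
split zer zer K M h = same refl (c+2*-cancel (+ 0) h)
split one one K M h = same refl (c+2*-cancel (+ 1) h)
split neg neg K M h = same refl (c+2*-cancel -[1+ 0 ] h)
split one neg K M h = opposite one-neg (sym (c+2*-cancel -[1+ 0 ] (trans (lemma (value K)) h)))
  where lemma : ∀ x → -[1+ 0 ] ℤ.+ + 2 ℤ.* (+ 1 ℤ.+ x) ≡ + 1 ℤ.+ + 2 ℤ.* x
        lemma = solve-∀
split neg one K M h = opposite neg-one (sym (c+2*-cancel (+ 1) (trans (lemma (value K)) h)))
  where lemma : ∀ x → + 1 ℤ.+ + 2 ℤ.* (-[1+ 0 ] ℤ.+ x) ≡ -[1+ 0 ] ℤ.+ + 2 ℤ.* x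
        lemma = solve-∀
split zer one K M h = ⊥-elim (1+2a≢2b (value M) (value K) (trans (sym h) (ℤP.+-identityˡ _)))
split one zer K M h = ⊥-elim (1+2a≢2b (value K) (value M) (trans h (ℤP.+-identityˡ _)))
split zer neg K M h =
  ⊥-elim (1+2a≢2b (value M ℤ.- + 1) (value K) (trans (1+2[y-1] (value M)) (trans (sym h) (ℤP.+-identityˡ _))))
split neg zer K M h =
  ⊥-elim (1+2a≢2b (value K ℤ.- + 1) (value M) (trans (1+2[y-1] (value K)) (trans h (ℤP.+-identityˡ _))))

opposite-cancel : ∀ {d e} → Opposite d e → ∀ x → dval d ℤ.+ (dval e ℤ.+ x) ≡ + 0 ℤ.+ x
opposite-cancel one-neg = solve-∀
opposite-cancel neg-one = solve-∀

double-digit : ∀ a x → a ℤ.+ (a ℤ.+ + 2 ℤ.* x) ≡ + 0 ℤ.+ + 2 ℤ.* (a ℤ.+ x)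
double-digit = solve-∀

weight-of-zero : ∀ L → value L ≡ + 0 → weight L ≡ 0
weight-of-zero []      h = refl
weight-of-zero (d ∷ L) h with split d zer L [] h
... | same refl h′ = weight-of-zero L h′

value-++-zer : ∀ L → value (L ++ zer ∷ []) ≡ value L
value-++-zer []      = refl
value-++-zer (d ∷ L) = cong (λ v → dval d ℤ.+ + 2 ℤ.* v) (value-++-zer L)

value-zeros-++ : ∀ ℓ {L L′} → value L ≡ value L′ → value (zeros ℓ ++ L) ≡ value (zeros ℓ ++ L′)
value-zeros-++ zero    L≡L′ = L≡L′
value-zeros-++ (suc ℓ) L≡L′ = cong (λ v → + 0 ℤ.+ + 2 ℤ.* v) (value-zeros-++ ℓ L≡L′)

lowest-one : ∀ {L} → Bits L → value L ≢ + 0 → Σ[ ℓ ∈ ℕ ] Σ[ κ ∈ List Digit ] L ≡ zeros ℓ ++ one ∷ κ × Bits κ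
lowest-one []          v≢0 = ⊥-elim (v≢0 refl)
lowest-one (bit1 ∷ bL) _   = 0 , _ , refl , bL
lowest-one (bit0 ∷ bL) v≢0 =
  let ℓ , κ , L≡ , bκ = lowest-one bL (λ v≡0 → v≢0 (cong (λ v → + 0 ℤ.+ + 2 ℤ.* v) v≡0))
  in  suc ℓ , κ , cong (zer ∷_) L≡ , bκ

trailing-zeros : ∀ ℓ M κ → value M ≡ value (zeros ℓ ++ one ∷ κ) →
                 Σ[ d ∈ Digit ] Σ[ M′ ∈ List Digit ]
                 M ≡ zeros ℓ ++ d ∷ M′ × Nonzero d × value (d ∷ M′) ≡ value (one ∷ κ)
trailing-zeros ℓ [] κ h = ⊥-elim (weight-∷≢0 κ one≢0
  (trans (sym (weight-zeros-++ ℓ (one ∷ κ))) (weight-of-zero (zeros ℓ ++ one ∷ κ) (sym h))))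
trailing-zeros zero (d ∷ M) κ h with split d one M κ h
... | same refl _          = one , M , refl , one≢0 , h
... | opposite neg-one _   = neg , M , refl , neg≢0 , h
trailing-zeros (suc ℓ) (d ∷ M) κ h with split d zer M (zeros ℓ ++ one ∷ κ) h
... | same refl h′ =
  let d′ , M′ , M≡ , d′≢0 , h″ = trailing-zeros ℓ M κ h′
  in  d′ , M′ , cong (zer ∷_) M≡ , d′≢0 , h″

data NAF : List Digit → Set where
  []    : NAF []
  0∷_   : ∀ {L} → NAF L → NAF (zer ∷ L)
  [_]   : ∀ {d} → Nonzero d → NAF (d ∷ [])
  _∷0∷_ : ∀ {d L} → Nonzero d → NAF L → NAF (d ∷ zer ∷ L)

NAF-tail : ∀ {d L} → NAF (d ∷ L) → NAF L
NAF-tail (0∷ n)    = n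
NAF-tail [ _ ]     = []
NAF-tail (_ ∷0∷ n) = 0∷ n

-- The conversion performed by toNAF

-- scan x R is what the loops of toNAF leave from index i upwards when n'_i = x and R lies above it;
-- carry R is the same after adding one to R.
mutual
  scan : Digit → List Digit → List Digit
  scan x   []        = x ∷ []
  scan one (one ∷ R) = neg ∷ zer ∷ carry R
  scan x   (y ∷ R)   = x ∷ scan y R

  carry : List Digit → List Digit
  carry []        = one ∷ []
  carry (one ∷ R) = zer ∷ carry R
  carry (_   ∷ R) = scan one R

naf : List Digit → List Digit
naf []      = []
naf (x ∷ R) = scan x R

mutual
  scan-value : ∀ {x R} → IsBit x → Bits R → value (scan x R) ≡ value (x ∷ R)
  scan-value bit0 []            = refl
  scan-value bit1 []            = refl
  scan-value bit0 (bit0 ∷ bR)   = cong (λ v → + 0 ℤ.+ + 2 ℤ.* v) (scan-value bit0 bR)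
  scan-value bit0 (bit1 ∷ bR)   = cong (λ v → + 0 ℤ.+ + 2 ℤ.* v) (scan-value bit1 bR)
  scan-value bit1 (bit0 ∷ bR)   = cong (λ v → + 1 ℤ.+ + 2 ℤ.* v) (scan-value bit0 bR)
  scan-value {R = one ∷ R} bit1 (bit1 ∷ bR) =
    trans (cong (λ v → -[1+ 0 ] ℤ.+ + 2 ℤ.* (+ 0 ℤ.+ + 2 ℤ.* v)) (carry-value bR)) (lemma (value R))
    where lemma : ∀ v → -[1+ 0 ] ℤ.+ + 2 ℤ.* (+ 0 ℤ.+ + 2 ℤ.* (+ 1 ℤ.+ v)) ≡ + 1 ℤ.+ + 2 ℤ.* (+ 1 ℤ.+ + 2 ℤ.* v)
          lemma = solve-∀

  carry-value : ∀ {R} → Bits R → value (carry R) ≡ + 1 ℤ.+ value R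
  carry-value []                   = refl
  carry-value {one ∷ R} (bit1 ∷ bR) = trans (cong (λ v → + 0 ℤ.+ + 2 ℤ.* v) (carry-value bR)) (lemma (value R))
    where lemma : ∀ v → + 0 ℤ.+ + 2 ℤ.* (+ 1 ℤ.+ v) ≡ + 1 ℤ.+ (+ 1 ℤ.+ + 2 ℤ.* v)
          lemma = solve-∀
  carry-value {zer ∷ R} (bit0 ∷ bR) = trans (scan-value bit1 bR) (lemma (value R))
    where lemma : ∀ v → + 1 ℤ.+ + 2 ℤ.* v ≡ + 1 ℤ.+ (+ 0 ℤ.+ + 2 ℤ.* v)
          lemma = solve-∀

naf-value : ∀ {R} → Bits R → value (naf R) ≡ value R
naf-value []         = refl
naf-value (bx ∷ bR)  = scan-value bx bR

scan-zer : ∀ R → scan zer R ≡ zer ∷ naf R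
scan-zer []      = refl
scan-zer (y ∷ R) = refl

mutual
  scan-NAF : ∀ {x R} → IsBit x → Bits R → NAF (scan x R)
  scan-NAF bit0 []          = 0∷ []
  scan-NAF bit1 []          = [ one≢0 ]
  scan-NAF bit0 (bit0 ∷ bR) = 0∷ scan-NAF bit0 bR
  scan-NAF bit0 (bit1 ∷ bR) = 0∷ scan-NAF bit1 bR
  scan-NAF {R = zer ∷ R} bit1 (bit0 ∷ bR) rewrite scan-zer R = one≢0 ∷0∷ naf-NAF bR
  scan-NAF bit1 (bit1 ∷ bR) = neg≢0 ∷0∷ carry-NAF bR

  naf-NAF : ∀ {R} → Bits R → NAF (naf R)
  naf-NAF []        = []
  naf-NAF (bx ∷ bR) = scan-NAF bx bR

  carry-NAF : ∀ {R} → Bits R → NAF (carry R)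
  carry-NAF []          = [ one≢0 ]
  carry-NAF (bit1 ∷ bR) = 0∷ carry-NAF bR
  carry-NAF (bit0 ∷ bR) = scan-NAF bit1 bR

-- The outer loop of toNAF stops at index λ, so it agrees with scan only when the top digit is 0;
-- toNAF supplies this digit as n'_{λ+1}.
data EndsInZero : List Digit → Set where
  zer∷[] : EndsInZero (zer ∷ [])
  _∷_    : ∀ d {L} → EndsInZero L → EndsInZero (d ∷ L)

++-zer-EndsInZero : ∀ L → EndsInZero (L ++ zer ∷ [])
++-zer-EndsInZero []      = zer∷[]
++-zer-EndsInZero (d ∷ L) = d ∷ ++-zer-EndsInZero L

mutual
  scan-length : ∀ {x R} → EndsInZero (x ∷ R) → length (scan x R) ≡ suc (length R)
  scan-length {R = []}          _               = refl
  scan-length {one} {one ∷ R}   (_ ∷ (_ ∷ ez))  = cong (λ n → suc (suc n)) (carry-length ez)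
  scan-length {one} {zer ∷ R}   (_ ∷ ez)        = cong suc (scan-length ez)
  scan-length {one} {neg ∷ R}   (_ ∷ ez)        = cong suc (scan-length ez)
  scan-length {zer} {y ∷ R}     (_ ∷ ez)        = cong suc (scan-length ez)
  scan-length {neg} {y ∷ R}     (_ ∷ ez)        = cong suc (scan-length ez)

  carry-length : ∀ {R} → EndsInZero R → length (carry R) ≡ length R
  carry-length zer∷[]          = refl
  carry-length (one ∷ ez)      = cong suc (carry-length ez)
  carry-length (zer ∷ ez)      = scan-length (one ∷ ez)
  carry-length (neg ∷ ez)      = scan-length (one ∷ ez)

scan-∷-zer : ∀ x R → scan x (zer ∷ R) ≡ x ∷ scan zer R
scan-∷-zer zer R = refl
scan-∷-zer one R = refl
scan-∷-zer neg R = refl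

<ᵇ-true : ∀ {m n} → m ℕ.< n → (m ℕ.<ᵇ n) ≡ true
<ᵇ-true {zero}  {suc n} _         = refl
<ᵇ-true {suc m} {suc n} (s≤s m<n) = <ᵇ-true m<n

<ᵇ-false : ∀ {m n} → n ≤ m → (m ℕ.<ᵇ n) ≡ false
<ᵇ-false {n = zero}        _         = refl
<ᵇ-false {suc m} {suc n}   (s≤s n≤m) = <ᵇ-false n≤m

≡ᵇ-refl : ∀ n → (n ℕ.≡ᵇ n) ≡ true
≡ᵇ-refl zero    = refl
≡ᵇ-refl (suc n) = ≡ᵇ-refl n

≡ᵇ-≢ : ∀ {m n} → m ≢ n → (m ℕ.≡ᵇ n) ≡ false
≡ᵇ-≢ {zero}  {zero}  m≢n = ⊥-elim (m≢n refl)
≡ᵇ-≢ {zero}  {suc n} _   = refl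
≡ᵇ-≢ {suc m} {zero}  _   = refl
≡ᵇ-≢ {suc m} {suc n} m≢n = ≡ᵇ-≢ (λ m≡n → m≢n (cong suc m≡n))

length-∷ʳ : ∀ P (x : Digit) → length (P ∷ʳ x) ≡ suc (length P)
length-∷ʳ []      x = refl
length-∷ʳ (_ ∷ P) x = cong suc (length-∷ʳ P x)

length-∷ʳ-+ : ∀ P (x : Digit) n → length (P ∷ʳ x) + n ≡ length P + suc n
length-∷ʳ-+ P x n = trans (cong (_+ n) (length-∷ʳ P x)) (sym (ℕP.+-suc (length P) n))

+≡suc⇒≤ : ∀ {p r n} → p + r ≡ suc n → r ≤ 1 → n ≤ p
+≡suc⇒≤ {p} {r} {n} eq r≤1 = ℕP.≤-pred (begin
  suc n ≡⟨ sym eq ⟩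
  p + r ≤⟨ ℕP.+-monoʳ-≤ p r≤1 ⟩
  p + 1 ≡⟨ ℕP.+-comm p 1 ⟩
  suc p ∎)
  where open ℕP.≤-Reasoning

+2+≡suc⇒< : ∀ {p r n} → p + suc (suc r) ≡ suc n → p ℕ.< n
+2+≡suc⇒< {p} {r} {n} eq = ℕP.≤-pred (begin
  suc (suc p)       ≡⟨ ℕP.+-comm 2 p ⟩
  p + 2             ≤⟨ ℕP.+-monoʳ-≤ p (s≤s (s≤s z≤n)) ⟩
  p + suc (suc r)   ≡⟨ eq ⟩
  suc n             ∎)
  where open ℕP.≤-Reasoning

dig-++-∷ : ∀ P x R → dig (P ++ x ∷ R) (length P) ≡ x
dig-++-∷ []      x R = refl
dig-++-∷ (_ ∷ P) x R = dig-++-∷ P x R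

dig-++-∷-∷ : ∀ P x y R → dig (P ++ x ∷ y ∷ R) (suc (length P)) ≡ y
dig-++-∷-∷ []      x y R = refl
dig-++-∷-∷ (_ ∷ P) x y R = dig-++-∷-∷ P x y R

dig-++-≢ : ∀ P x d R {k} → k ≢ length P → dig (P ++ x ∷ R) k ≡ dig (P ++ d ∷ R) k
dig-++-≢ []      x d R {zero}  k≢0 = ⊥-elim (k≢0 refl)
dig-++-≢ []      x d R {suc k} _   = refl
dig-++-≢ (_ ∷ P) x d R {zero}  _   = refl
dig-++-≢ (_ ∷ P) x d R {suc k} k≢  = dig-++-≢ P x d R (λ k≡ → k≢ (cong suc k≡))

dig-∷ʳ-++ : ∀ P (x : Digit) R → dig ((P ∷ʳ x) ++ R) ≗ dig (P ++ x ∷ R)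
dig-∷ʳ-++ P x R k = cong (λ L → dig L k) (ListP.∷ʳ-++ P x R)

set-++-∷ : ∀ P {x R f} d → f ≗ dig (P ++ x ∷ R) → set f (length P) d ≗ dig (P ++ d ∷ R)
set-++-∷ P {x} {R} {f} d f≗ k with k ℕP.≟ length P
... | yes refl rewrite ≡ᵇ-refl (length P) = sym (dig-++-∷ P d R)
... | no k≢    rewrite ≡ᵇ-≢ k≢           = trans (f≗ k) (dig-++-≢ P x d R k≢)

set-∷ʳ : ∀ P {x R f} d → f ≗ dig (P ++ x ∷ R) → set f (length P) d ≗ dig ((P ∷ʳ d) ++ R)
set-∷ʳ P {R = R} d f≗ k = trans (set-++-∷ P d f≗ k) (sym (dig-∷ʳ-++ P d R k))

module Simulation (λ′ : ℕ) where

  resume : ℕ → State → Arr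
  resume fuel s = outerLoop λ′ fuel (st (set (State.arr s) (State.idx s) one) (State.idx s))

  outerLoop-stop : ∀ fuel f i → λ′ ≤ i → outerLoop λ′ fuel (st f i) ≡ f
  outerLoop-stop zero       f i _    = refl
  outerLoop-stop (suc fuel) f i λ′≤i rewrite <ᵇ-false λ′≤i = refl

  outerLoop-skip : ∀ fuel f i → i ℕ.< λ′ → (isOne (f i) ∧ isOne (f (suc i))) ≡ false →
                   outerLoop λ′ (suc fuel) (st f i) ≡ outerLoop λ′ fuel (st f (suc i))
  outerLoop-skip fuel f i i<λ′ no-pair rewrite <ᵇ-true i<λ′ | no-pair = refl

  outerLoop-pair : ∀ fuel f i → i ℕ.< λ′ → f i ≡ one → f (suc i) ≡ one →
                   outerLoop λ′ (suc fuel) (st f i) ≡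
                   resume fuel (innerLoop (suc (suc λ′)) (st (set f i neg) (suc i)))
  outerLoop-pair fuel f i i<λ′ fi fsi rewrite <ᵇ-true i<λ′ | fi | fsi = refl

  innerLoop-one : ∀ fuel g j → g j ≡ one → innerLoop (suc fuel) (st g j) ≡ innerLoop fuel (st (set g j zer) (suc j))
  innerLoop-one fuel g j gj rewrite gj = refl

  innerLoop-zer : ∀ fuel g j → g j ≡ zer → innerLoop (suc fuel) (st g j) ≡ st g j
  innerLoop-zer fuel g j gj rewrite gj = refl

  mutual
    outer-sim : ∀ fuel P {i x R f} → length P ≡ i → IsBit x → Bits R → EndsInZero (x ∷ R) →
                length P + length R ≡ suc λ′ → length R ≤ suc fuel →
                f ≗ dig (P ++ x ∷ R) → outerLoop λ′ fuel (st f i) ≗ dig (P ++ scan x R)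
    outer-sim fuel P {R = []} {f} refl _ _ _ len _ f≗ k =
      trans (cong-app (outerLoop-stop fuel f _ (+≡suc⇒≤ len z≤n)) k) (f≗ k)
    outer-sim fuel P {x = x} {zer ∷ []} {f} refl _ _ _ len _ f≗ k =
      trans (cong-app (outerLoop-stop fuel f _ (+≡suc⇒≤ len ℕP.≤-refl)) k)
            (trans (f≗ k) (cong (λ L → dig (P ++ L) k) (sym (scan-∷-zer x []))))
    outer-sim fuel P {R = _ ∷ []} _ _ _ (_ ∷ (_ ∷ ())) _ _ _
    outer-sim zero P {R = _ ∷ _ ∷ _} _ _ _ _ _ (s≤s ()) _
    outer-sim (suc fuel) P {R = one ∷ _ ∷ _} refl bit1 (bit1 ∷ bR) (_ ∷ (_ ∷ ez)) len fuel-ok f≗ =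
      outer-pair fuel P (+2+≡suc⇒< len) bR ez len (ℕP.≤-pred fuel-ok) f≗
    outer-sim (suc fuel) P {R = _ ∷ _ ∷ _} refl bit0 (by ∷ bR) (_ ∷ ez) len fuel-ok f≗ =
      outer-skip fuel P (+2+≡suc⇒< len) refl refl by bR ez len (ℕP.≤-pred fuel-ok) f≗
    outer-sim (suc fuel) P {R = _ ∷ _ ∷ _} refl bit1 (bit0 ∷ bR) (_ ∷ ez) len fuel-ok f≗ =
      outer-skip fuel P (+2+≡suc⇒< len) refl refl bit0 bR ez len (ℕP.≤-pred fuel-ok) f≗

    outer-skip : ∀ fuel P {x y R f} → length P ℕ.< λ′ → (isOne x ∧ isOne y) ≡ false →
                 scan x (y ∷ R) ≡ x ∷ scan y R → IsBit y → Bits R → EndsInZero (y ∷ R) →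
                 length P + suc (length R) ≡ suc λ′ → length R ≤ suc fuel → f ≗ dig (P ++ x ∷ y ∷ R) →
                 outerLoop λ′ (suc fuel) (st f (length P)) ≗ dig (P ++ scan x (y ∷ R))
    outer-skip fuel P {x} {y} {R} {f} P<λ′ no-pair scan-x∷y∷R by bR ez len fuel-ok f≗ k = begin
      outerLoop λ′ (suc fuel) (st f (length P)) k
        ≡⟨ cong-app (outerLoop-skip fuel f (length P) P<λ′ no-pair′) k ⟩
      outerLoop λ′ fuel (st f (suc (length P))) k
        ≡⟨ outer-sim fuel (P ∷ʳ x) (length-∷ʳ P x) by bR ez (trans (length-∷ʳ-+ P x (length R)) len)
                     fuel-ok (λ k → trans (f≗ k) (sym (dig-∷ʳ-++ P x (y ∷ R) k))) k ⟩
      dig ((P ∷ʳ x) ++ scan y R) k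
        ≡⟨ dig-∷ʳ-++ P x (scan y R) k ⟩
      dig (P ++ x ∷ scan y R) k
        ≡⟨ cong (λ L → dig (P ++ L) k) (sym scan-x∷y∷R) ⟩
      dig (P ++ scan x (y ∷ R)) k ∎
      where
      open ≡-Reasoning
      no-pair′ : (isOne (f (length P)) ∧ isOne (f (suc (length P)))) ≡ false
      no-pair′ = trans (cong₂ (λ a b → isOne a ∧ isOne b) (trans (f≗ _) (dig-++-∷ P x _))
                                                        (trans (f≗ _) (dig-++-∷-∷ P x y R))) no-pair

    outer-pair : ∀ fuel P {R f} → length P ℕ.< λ′ → Bits R → EndsInZero R → length P + suc (length R) ≡ suc λ′ →
                 length R ≤ suc fuel → f ≗ dig (P ++ one ∷ one ∷ R) →
                 outerLoop λ′ (suc fuel) (st f (length P)) ≗ dig (P ++ scan one (one ∷ R))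
    outer-pair fuel P {R} {f} P<λ′ bR ez len fuel-ok f≗ k = begin
      outerLoop λ′ (suc fuel) (st f (length P)) k
        ≡⟨ cong-app (outerLoop-pair fuel f (length P) P<λ′
                      (trans (f≗ _) (dig-++-∷ P one _)) (trans (f≗ _) (dig-++-∷-∷ P one one R))) k ⟩
      resume fuel (innerLoop (suc (suc λ′)) (st (set f (length P) neg) (suc (length P)))) k
        ≡⟨ inner-sim (suc (suc λ′)) fuel (P ∷ʳ neg) (length-∷ʳ P neg) (bit1 ∷ bR) (one ∷ ez)
             (trans (length-∷ʳ-+ P neg (suc (length R))) (trans (ℕP.+-suc (length P) _) (cong suc len)))
             (ℕP.≤-trans (ℕP.m≤n+m _ (length P)) (ℕP.≤-trans (ℕP.≤-reflexive len) (ℕP.n≤1+n _)))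
             fuel-ok (set-∷ʳ P neg f≗) k ⟩
      dig ((P ∷ʳ neg) ++ zer ∷ carry R) k
        ≡⟨ dig-∷ʳ-++ P neg (zer ∷ carry R) k ⟩
      dig (P ++ scan one (one ∷ R)) k ∎
      where open ≡-Reasoning

    inner-sim : ∀ ifuel ofuel P {i d R g} → length P ≡ i → Bits (d ∷ R) → EndsInZero (d ∷ R) →
                length P + length (d ∷ R) ≡ suc (suc λ′) → length (d ∷ R) ≤ ifuel → length R ≤ suc ofuel →
                g ≗ dig (P ++ d ∷ R) → resume ofuel (innerLoop ifuel (st g i)) ≗ dig (P ++ carry (d ∷ R))
    inner-sim zero ofuel P _ _ _ _ () _ _
    inner-sim (suc ifuel) ofuel P {d = one} {[]} _ _ (_ ∷ ()) _ _ _ _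
    inner-sim (suc ifuel) ofuel P {d = one} {d′ ∷ R} {g} refl (bit1 ∷ bR) (_ ∷ ez) len ifuel-ok ofuel-ok g≗ k = begin
      resume ofuel (innerLoop (suc ifuel) (st g (length P))) k
        ≡⟨ cong (λ s → resume ofuel s k) (innerLoop-one ifuel g (length P) (trans (g≗ _) (dig-++-∷ P one _))) ⟩
      resume ofuel (innerLoop ifuel (st (set g (length P) zer) (suc (length P)))) k
        ≡⟨ inner-sim ifuel ofuel (P ∷ʳ zer) (length-∷ʳ P zer) bR ez (trans (length-∷ʳ-+ P zer _) len)
                     (ℕP.≤-pred ifuel-ok) (ℕP.≤-trans (ℕP.n≤1+n _) ofuel-ok) (set-∷ʳ P zer g≗) k ⟩
      dig ((P ∷ʳ zer) ++ carry (d′ ∷ R)) k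
        ≡⟨ dig-∷ʳ-++ P zer (carry (d′ ∷ R)) k ⟩
      dig (P ++ carry (one ∷ d′ ∷ R)) k ∎
      where open ≡-Reasoning
    inner-sim (suc ifuel) ofuel P {d = zer} {[]} {g} refl _ _ len _ _ g≗ k =
      trans (cong (λ s → resume ofuel s k) (innerLoop-zer ifuel g (length P) (trans (g≗ _) (dig-++-∷ P zer _))))
            (trans (cong-app (outerLoop-stop ofuel _ (length P)
                                (ℕP.≤-trans (ℕP.n≤1+n λ′) (+≡suc⇒≤ len ℕP.≤-refl))) k)
                   (set-++-∷ P one g≗ k))
    inner-sim (suc ifuel) ofuel P {d = zer} {_ ∷ _} {g} refl (bit0 ∷ bR) (_ ∷ ez) len _ ofuel-ok g≗ k =
      trans (cong (λ s → resume ofuel s k) (innerLoop-zer ifuel g (length P) (trans (g≗ _) (dig-++-∷ P zer _))))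
            (outer-sim ofuel P refl bit1 bR (one ∷ ez) (ℕP.suc-injective (trans (sym (ℕP.+-suc (length P) _)) len))
                       ofuel-ok (set-++-∷ P one g≗) k)

toList-tabulate : ∀ n {F} L → length L ≡ n → F ≗ dig L → toList (tabulate {n = n} (λ j → F (toℕ j))) ≡ L
toList-tabulate zero    []      _   _   = refl
toList-tabulate (suc n) (d ∷ L) len F≗ =
  cong₂ _∷_ (F≗ 0) (toList-tabulate n L (ℕP.suc-injective len) (λ k → F≗ (suc k)))

dig-++-zer : ∀ L → dig (L ++ zer ∷ []) ≗ dig L
dig-++-zer []      zero    = refl
dig-++-zer []      (suc k) = refl
dig-++-zer (d ∷ L) zero    = refl
dig-++-zer (d ∷ L) (suc k) = dig-++-zer L k

toNAF-naf : ∀ {λ′} (N : Vec Digit (suc λ′)) P {L i} → length P ≡ i → toList N ++ zer ∷ [] ≡ P ++ L →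
            Bits L → EndsInZero L → toList (toNAF N i) ≡ P ++ naf L
toNAF-naf {λ′} N P {x ∷ R} refl N0≡ (bx ∷ bR) ez =
  toList-tabulate (suc (suc λ′)) (P ++ scan x R) out-length
    (Simulation.outer-sim λ′ (suc λ′) P refl bx bR ez P+R≡ R≤ dig-N≗)
  where
  total : length P + suc (length R) ≡ suc (suc λ′)
  total = begin
    length P + suc (length R)        ≡⟨ ListP.length-++ P ⟨
    length (P ++ x ∷ R)              ≡⟨ cong length N0≡ ⟨
    length (toList N ++ zer ∷ [])    ≡⟨ ListP.length-++ (toList N) ⟩
    length (toList N) + 1            ≡⟨ cong (_+ 1) (VecP.length-toList N) ⟩
    suc λ′ + 1                       ≡⟨ ℕP.+-comm (suc λ′) 1 ⟩
    suc (suc λ′)                     ∎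
    where open ≡-Reasoning
  P+R≡ : length P + length R ≡ suc λ′
  P+R≡ = ℕP.suc-injective (trans (sym (ℕP.+-suc (length P) (length R))) total)
  R≤ : length R ≤ suc (suc λ′)
  R≤ = ℕP.≤-trans (ℕP.m≤n+m (length R) (length P)) (ℕP.≤-trans (ℕP.≤-reflexive P+R≡) (ℕP.n≤1+n _))
  dig-N≗ : dig (toList N) ≗ dig (P ++ x ∷ R)
  dig-N≗ k = trans (sym (dig-++-zer (toList N) k)) (cong (λ L → dig L k) N0≡)
  out-length : length (P ++ scan x R) ≡ suc (suc λ′)
  out-length = trans (ListP.length-++ P) (trans (cong (ℕ._+_ (length P)) (scan-length ez)) total)

setV-∷ : ∀ {m} (N : Vec Digit m) P {x R i} d → length P ≡ i → toList N ≡ P ++ x ∷ R →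
         toList (setV N i d) ≡ P ++ d ∷ R
setV-∷ {m} N P {x} {R} d refl N≡ =
  toList-tabulate m (P ++ d ∷ R) d-length (set-++-∷ P d (λ k → cong (λ L → dig L k) N≡))
  where
  open ≡-Reasoning
  d-length : length (P ++ d ∷ R) ≡ m
  d-length = begin
    length (P ++ d ∷ R)        ≡⟨ ListP.length-++ P ⟩
    length P + length (x ∷ R)  ≡⟨ ListP.length-++ P ⟨
    length (P ++ x ∷ R)        ≡⟨ cong length N≡ ⟨
    length (toList N)          ≡⟨ VecP.length-toList N ⟩
    m                          ∎

-- The pattern tests of Algorithm 2 for N_B = κ 1 0^ℓ (κ stored least significant digit first).
test₁ test₂ : List Digit → Bool
test₁ κ = endsWith₁ (one ∷ κ ++ zer ∷ zer ∷ [])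
test₂ κ = endsWith₂ (one ∷ κ ++ zer ∷ zer ∷ [])

tail₂≡not-tail₁ : ∀ {L} → Bits L → tail₂ (L ++ zer ∷ zer ∷ []) ≡ not (tail₁ (L ++ zer ∷ zer ∷ []))
tail₂≡not-tail₁ []                 = refl
tail₂≡not-tail₁ (bit0 ∷ _)         = refl
tail₂≡not-tail₁ (bit1 ∷ [])        = refl
tail₂≡not-tail₁ (bit1 ∷ bit0 ∷ bL) = tail₂≡not-tail₁ bL
tail₂≡not-tail₁ (bit1 ∷ bit1 ∷ _)  = refl

padded-≡ : ∀ L → padded L ≡ L ++ zer ∷ zer ∷ []
padded-≡ []      = refl
padded-≡ (d ∷ L) = cong (d ∷_) (padded-≡ L)

endsWith₁-zeros : ∀ ℓ κ → endsWith₁ (padded (zeros ℓ ++ one ∷ κ)) ≡ test₁ κ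
endsWith₁-zeros zero    κ = cong (λ L → endsWith₁ (one ∷ L)) (padded-≡ κ)
endsWith₁-zeros (suc ℓ) κ = endsWith₁-zeros ℓ κ

endsWith₂-zeros : ∀ ℓ κ → endsWith₂ (padded (zeros ℓ ++ one ∷ κ)) ≡ test₂ κ
endsWith₂-zeros zero    κ = cong (λ L → endsWith₂ (one ∷ L)) (padded-≡ κ)
endsWith₂-zeros (suc ℓ) κ = endsWith₂-zeros ℓ κ

lowestOne-zeros : ∀ ℓ κ → lowestOne (zeros ℓ ++ one ∷ κ) ≡ ℓ
lowestOne-zeros zero    κ = refl
lowestOne-zeros (suc ℓ) κ = cong suc (lowestOne-zeros ℓ κ)

branch : ∀ {λ′} → Vec Digit (suc λ′) → Bool → Bool → ℕ → Vec Digit (suc (suc λ′))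
branch NB b₁ b₂ ℓ =
  if b₁ then toNAF (setV (setV NB ℓ neg) (suc ℓ) one) (suc ℓ)
  else (if b₂ then toNAF NB (suc ℓ) else toNAF NB ℓ)

algorithm2-branch : ∀ {λ′} (NB : Vec Digit (suc λ′)) ℓ κ → toList NB ≡ zeros ℓ ++ one ∷ κ →
                    algorithm2 NB ≡ branch NB (test₁ κ) (test₂ κ) ℓ
algorithm2-branch NB ℓ κ NB≡ = begin
  algorithm2 NB
    ≡⟨ cong (λ L → branch NB (endsWith₁ (padded L)) (endsWith₂ (padded L)) (lowestOne L)) NB≡ ⟩
  branch NB (endsWith₁ (padded N)) (endsWith₂ (padded N)) (lowestOne N)
    ≡⟨ cong₂ (λ b₁ b₂ → branch NB b₁ b₂ (lowestOne N)) (endsWith₁-zeros ℓ κ) (endsWith₂-zeros ℓ κ) ⟩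
  branch NB (test₁ κ) (test₂ κ) (lowestOne N)
    ≡⟨ cong (branch NB (test₁ κ) (test₂ κ)) (lowestOne-zeros ℓ κ) ⟩
  branch NB (test₁ κ) (test₂ κ) ℓ ∎
  where
  open ≡-Reasoning
  N = zeros ℓ ++ one ∷ κ

candidate : Bool → Bool → List Digit → List Digit
candidate true  _     β = neg ∷ carry β
candidate false true  β = one ∷ naf β
candidate false false β = scan one β

algorithm2-output : ∀ {λ′} (NB : Vec Digit (suc λ′)) ℓ κ → toList NB ≡ zeros ℓ ++ one ∷ κ → Bits κ →
                    toList (algorithm2 NB) ≡ zeros ℓ ++ candidate (test₁ κ) (test₂ κ) (κ ++ zer ∷ [])
algorithm2-output NB ℓ κ NB≡ bκ rewrite algorithm2-branch NB ℓ κ NB≡ = output κ bκ NB≡ refl refl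
  where
  NB0≡ : ∀ {κ} → toList NB ≡ zeros ℓ ++ one ∷ κ → toList NB ++ zer ∷ [] ≡ zeros ℓ ++ one ∷ κ ++ zer ∷ []
  NB0≡ {κ} NB≡ = trans (cong (_++ zer ∷ []) NB≡) (ListP.++-assoc (zeros ℓ) (one ∷ κ) (zer ∷ []))
  zeros-length : length (zeros ℓ) ≡ ℓ
  zeros-length = ListP.length-replicate ℓ
  zeros∷ʳ-length : ∀ d → length (zeros ℓ ∷ʳ d) ≡ suc ℓ
  zeros∷ʳ-length d = trans (length-∷ʳ (zeros ℓ) d) (cong suc zeros-length)
  output : ∀ κ → Bits κ → toList NB ≡ zeros ℓ ++ one ∷ κ → ∀ {b₁ b₂} → test₁ κ ≡ b₁ → test₂ κ ≡ b₂ →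
           toList (branch NB b₁ b₂ ℓ) ≡ zeros ℓ ++ candidate b₁ b₂ (κ ++ zer ∷ [])
  output [] _ _ {true} () _
  output (one ∷ _) _ _ {true} () _
  output (zer ∷ κ′) (_ ∷ bκ′) NB≡ {true} _ _ = begin
    toList (toNAF NB₂ (suc ℓ))                    ≡⟨ toNAF-naf NB₂ (zeros ℓ ∷ʳ neg) (zeros∷ʳ-length neg) NB₂0≡ (bit1 ∷ bβ′)
                                                                (one ∷ ++-zer-EndsInZero κ′) ⟩
    (zeros ℓ ∷ʳ neg) ++ scan one (κ′ ++ zer ∷ []) ≡⟨ ListP.∷ʳ-++ (zeros ℓ) neg _ ⟩
    zeros ℓ ++ neg ∷ carry (zer ∷ κ′ ++ zer ∷ []) ∎
    where
    open ≡-Reasoning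
    bβ′ = ++-zer-Bits bκ′
    NB₁ = setV NB ℓ neg
    NB₂ = setV NB₁ (suc ℓ) one
    NB₂≡ : toList NB₂ ≡ (zeros ℓ ∷ʳ neg) ++ one ∷ κ′
    NB₂≡ = setV-∷ NB₁ (zeros ℓ ∷ʳ neg) one (zeros∷ʳ-length neg)
             (trans (setV-∷ NB (zeros ℓ) neg zeros-length NB≡) (sym (ListP.∷ʳ-++ (zeros ℓ) neg (zer ∷ κ′))))
    NB₂0≡ : toList NB₂ ++ zer ∷ [] ≡ (zeros ℓ ∷ʳ neg) ++ one ∷ κ′ ++ zer ∷ []
    NB₂0≡ = trans (cong (_++ zer ∷ []) NB₂≡) (ListP.++-assoc (zeros ℓ ∷ʳ neg) (one ∷ κ′) (zer ∷ []))
  output κ bκ NB≡ {false} {true} _ _ = begin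
    toList (toNAF NB (suc ℓ))                    ≡⟨ toNAF-naf NB (zeros ℓ ∷ʳ one) (zeros∷ʳ-length one)
                                                      (trans (NB0≡ NB≡) (sym (ListP.∷ʳ-++ (zeros ℓ) one _)))
                                                      (++-zer-Bits bκ) (++-zer-EndsInZero κ) ⟩
    (zeros ℓ ∷ʳ one) ++ naf (κ ++ zer ∷ [])      ≡⟨ ListP.∷ʳ-++ (zeros ℓ) one _ ⟩
    zeros ℓ ++ one ∷ naf (κ ++ zer ∷ [])         ∎
    where open ≡-Reasoning
  output κ bκ NB≡ {false} {false} _ _ =
    toNAF-naf NB (zeros ℓ) zeros-length (NB0≡ NB≡) (bit1 ∷ ++-zer-Bits bκ) (one ∷ ++-zer-EndsInZero κ)

-- Costs

ℕtoℚ-mkℚ : ∀ m → ℕtoℚ m ≡ mkℚ (+ m) 0 (Coprime.sym (Coprime.1-coprimeTo m))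
ℕtoℚ-mkℚ m = ℚP.normalize-coprime (Coprime.sym (Coprime.1-coprimeTo m))

ℕtoℚ-suc : ∀ m → ℕtoℚ (suc m) ≡ 1ℚ ℚ.+ ℕtoℚ m
ℕtoℚ-suc m = trans (cong (ℚ._/ 1) (suc-as-sum (+ m))) (cong (1ℚ ℚ.+_) (sym (ℕtoℚ-mkℚ m)))
  where
  suc-as-sum : ∀ x → + 1 ℤ.+ x ≡ + 1 ℤ.* + 1 ℤ.+ x ℤ.* + 1
  suc-as-sum = solve-∀

ℕtoℚ-mono-≤ : ∀ {m n} → m ≤ n → ℕtoℚ m ≤ℚ ℕtoℚ n
ℕtoℚ-mono-≤ {m} {n} m≤n = subst₂ _≤ℚ_ (sym (ℕtoℚ-mkℚ m)) (sym (ℕtoℚ-mkℚ n))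
  (ℚ.*≤* (ℤP.*-monoʳ-≤-nonNeg (+ 1) (ℤ.+≤+ m≤n)))

ℕtoℚ-nonNeg : ∀ m → 0ℚ ≤ℚ ℕtoℚ m
ℕtoℚ-nonNeg m = ℕtoℚ-mono-≤ {0} {m} z≤n

dig-zeros-< : ∀ {ℓ i} L → i ℕ.< ℓ → dig (zeros ℓ ++ L) i ≡ zer
dig-zeros-< {suc ℓ} {zero}  L _         = refl
dig-zeros-< {suc ℓ} {suc i} L (s≤s i<ℓ) = dig-zeros-< L i<ℓ

dig-zeros-≡ : ∀ ℓ s K → dig (zeros ℓ ++ s ∷ K) ℓ ≡ s
dig-zeros-≡ zero    s K = refl
dig-zeros-≡ (suc ℓ) s K = dig-zeros-≡ ℓ s K

dig-zeros-> : ∀ ℓ s K i → dig (zeros ℓ ++ s ∷ K) (suc (ℓ + i)) ≡ dig K i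
dig-zeros-> zero    s K i = refl
dig-zeros-> (suc ℓ) s K i = dig-zeros-> ℓ s K i

lowerZero-zeros : ∀ {ℓ i} L → i ≤ ℓ → lowerZero (zeros ℓ ++ L) i ≡ true
lowerZero-zeros {i = zero}  L _   = refl
lowerZero-zeros {i = suc i} L i<ℓ rewrite dig-zeros-< L i<ℓ = lowerZero-zeros L (ℕP.<⇒≤ i<ℓ)

lowerZero-> : ∀ ℓ {s} K → Nonzero s → ∀ i → lowerZero (zeros ℓ ++ s ∷ K) (suc (ℓ + i)) ≡ false
lowerZero-> ℓ {s} K s≢0 zero =
  subst (λ i → lowerZero (zeros ℓ ++ s ∷ K) (suc i) ≡ false) (sym (ℕP.+-identityʳ ℓ)) (at-ℓ s≢0)
  where
  at-ℓ : ∀ {s} → Nonzero s → lowerZero (zeros ℓ ++ s ∷ K) (suc ℓ) ≡ false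
  at-ℓ one≢0 rewrite dig-zeros-≡ ℓ one K = refl
  at-ℓ neg≢0 rewrite dig-zeros-≡ ℓ neg K = refl
lowerZero-> ℓ K s≢0 (suc i) rewrite ℕP.+-suc ℓ i | lowerZero-> ℓ K s≢0 i = BoolP.∧-zeroʳ _

module Cost (D A : ℚ) (0≤D : 0ℚ ≤ℚ D) (2D≤A : D ℚ.+ D ≤ℚ A) where

  open +-*-Solver

  0≤A : 0ℚ ≤ℚ A
  0≤A = ℚP.≤-trans (ℚP.+-mono-≤ 0≤D 0≤D) 2D≤A

  costAt : ℕ → ℕ → ℚ
  costAt p m = ℕtoℚ p * D ℚ.+ ℕtoℚ m * A

  instance
    D-nonNeg : ℚ.NonNegative D
    D-nonNeg = ℚ.nonNegative 0≤D
    A-nonNeg : ℚ.NonNegative A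
    A-nonNeg = ℚ.nonNegative 0≤A

  costAt-mono-≤ : ∀ {p p′ m m′} → p ≤ p′ → m ≤ m′ → costAt p m ≤ℚ costAt p′ m′
  costAt-mono-≤ p≤p′ m≤m′ = ℚP.+-mono-≤ (ℚP.*-monoʳ-≤-nonNeg D (ℕtoℚ-mono-≤ p≤p′))
                                         (ℚP.*-monoʳ-≤-nonNeg A (ℕtoℚ-mono-≤ m≤m′))

  costAt-nonNeg : ∀ p m → 0ℚ ≤ℚ costAt p m
  costAt-nonNeg p m = subst (_≤ℚ costAt p m) costAt-0-0 (costAt-mono-≤ {0} {p} {0} {m} z≤n z≤n)
    where
    costAt-0-0 : costAt 0 0 ≡ 0ℚ
    costAt-0-0 = cong₂ ℚ._+_ (ℚP.*-zeroˡ D) (ℚP.*-zeroˡ A)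

  -- This is where A ≥ 2D enters: two more doublings cost no more than one more addition.
  costAt-2+≤costAt-1+ : ∀ p m → costAt (2 ℕ.+ p) m ≤ℚ costAt p (suc m)
  costAt-2+≤costAt-1+ p m = begin
    costAt (2 ℕ.+ p) m                           ≡⟨ cong (λ x → x * D ℚ.+ ℕtoℚ m * A) (ℕtoℚ-2+ p) ⟩
    (1ℚ ℚ.+ (1ℚ ℚ.+ ℕtoℚ p)) * D ℚ.+ ℕtoℚ m * A ≡⟨ lhs-nf (ℕtoℚ p) (ℕtoℚ m) D A ⟩
    costAt p m ℚ.+ (D ℚ.+ D)                      ≤⟨ ℚP.+-monoʳ-≤ (costAt p m) 2D≤A ⟩
    costAt p m ℚ.+ A                              ≡⟨ rhs-nf (ℕtoℚ p) (ℕtoℚ m) D A ⟩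
    ℕtoℚ p * D ℚ.+ (1ℚ ℚ.+ ℕtoℚ m) * A           ≡⟨ cong (λ x → ℕtoℚ p * D ℚ.+ x * A) (sym (ℕtoℚ-suc m)) ⟩
    costAt p (suc m)                              ∎
    where
    open ℚP.≤-Reasoning
    ℕtoℚ-2+ : ∀ p → ℕtoℚ (2 ℕ.+ p) ≡ 1ℚ ℚ.+ (1ℚ ℚ.+ ℕtoℚ p)
    ℕtoℚ-2+ p = trans (ℕtoℚ-suc (suc p)) (cong (1ℚ ℚ.+_) (ℕtoℚ-suc p))
    lhs-nf : ∀ x y d a → (1ℚ ℚ.+ (1ℚ ℚ.+ x)) * d ℚ.+ y * a ≡ (x * d ℚ.+ y * a) ℚ.+ (d ℚ.+ d)
    lhs-nf = solve 4 (λ x y d a → (con 1ℚ :+ (con 1ℚ :+ x)) :* d :+ y :* a := (x :* d :+ y :* a) :+ (d :+ d)) refl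
    rhs-nf : ∀ x y d a → (x * d ℚ.+ y * a) ℚ.+ a ≡ x * d ℚ.+ (1ℚ ℚ.+ y) * a
    rhs-nf = solve 4 (λ x y d a → (x :* d :+ y :* a) :+ a := x :* d :+ (con 1ℚ :+ y) :* a) refl

  costAt-1+≤costAt-1+ : ∀ p m → costAt (suc p) m ≤ℚ costAt p (suc m)
  costAt-1+≤costAt-1+ p m = ℚP.≤-trans (costAt-mono-≤ (ℕP.n≤1+n (suc p)) (ℕP.≤-refl {m})) (costAt-2+≤costAt-1+ p m)

  -- The additions for the nonzero digits at positions ≥ p run one after
  -- another, and the first of them cannot start before time pD.
  mutual
    peak : ℕ → List Digit → ℚ
    peak p []        = 0ℚ
    peak p (zer ∷ L) = peak (suc p) L
    peak p (_   ∷ L) = peak∷ p L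

    peak∷ : ℕ → List Digit → ℚ
    peak∷ p L = costAt p (suc (weight L)) ⊔ peak (suc p) L

  peak-∷ : ∀ {d} p L → Nonzero d → peak p (d ∷ L) ≡ peak∷ p L
  peak-∷ p L one≢0 = refl
  peak-∷ p L neg≢0 = refl

  peak-nonNeg : ∀ p L → 0ℚ ≤ℚ peak p L
  peak-nonNeg p []        = ℚP.≤-refl
  peak-nonNeg p (zer ∷ L) = peak-nonNeg (suc p) L
  peak-nonNeg p (one ∷ L) = ℚP.p≤q⇒p≤q⊔r (peak (suc p) L) (costAt-nonNeg p (suc (weight L)))
  peak-nonNeg p (neg ∷ L) = ℚP.p≤q⇒p≤q⊔r (peak (suc p) L) (costAt-nonNeg p (suc (weight L)))

  peak-of-zero : ∀ p L → value L ≡ + 0 → peak p L ≡ 0ℚ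
  peak-of-zero p []      h = refl
  peak-of-zero p (d ∷ L) h with split d zer L [] h
  ... | same refl h′ = peak-of-zero (suc p) L h′

  peak≤peak∷ : ∀ p L → peak (suc p) L ≤ℚ peak∷ p L
  peak≤peak∷ p L = ℚP.p≤q⊔p (costAt p (suc (weight L))) (peak (suc p) L)

  infix 4 _≼[_]_

  record _≼[_]_ (K : List Digit) (p : ℕ) (M : List Digit) : Set where
    constructor _,_
    field
      weight-≤ : weight K ≤ weight M
      peak-≤   : peak p K ≤ℚ peak p M

  ≼-refl : ∀ {p K} → K ≼[ p ] K
  ≼-refl = ℕP.≤-refl , ℚP.≤-refl

  ≼-trans : ∀ {p K L M} → K ≼[ p ] L → L ≼[ p ] M → K ≼[ p ] M
  ≼-trans (w₁ , c₁) (w₂ , c₂) = ℕP.≤-trans w₁ w₂ , ℚP.≤-trans c₁ c₂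

  ∷-≼-∷ : ∀ {d e p K M} → Nonzero d → Nonzero e →
          weight K ≤ weight M → peak (suc p) K ≤ℚ peak∷ p M → d ∷ K ≼[ p ] e ∷ M
  ∷-≼-∷ {d} {e} {p} {K} {M} d≢0 e≢0 wK≤wM c =
    subst₂ _≤_ (sym (weight-∷ K d≢0)) (sym (weight-∷ M e≢0)) (s≤s wK≤wM) ,
    subst₂ _≤ℚ_ (sym (peak-∷ p K d≢0)) (sym (peak-∷ p M e≢0))
      (ℚP.⊔-lub (ℚP.p≤q⇒p≤q⊔r _ (costAt-mono-≤ (ℕP.≤-refl {p}) (s≤s wK≤wM))) c)

  ≼-∷ : ∀ d p K M → K ≼[ suc p ] M → d ∷ K ≼[ p ] d ∷ M
  ≼-∷ zer p K M (w , c) = w , c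
  ≼-∷ one p K M (w , c) = ∷-≼-∷ {K = K} {M} one≢0 one≢0 w (ℚP.≤-trans c (peak≤peak∷ p M))
  ≼-∷ neg p K M (w , c) = ∷-≼-∷ {K = K} {M} neg≢0 neg≢0 w (ℚP.≤-trans c (peak≤peak∷ p M))

  -- Non-adjacent forms are optimal

  peak∷-nonNeg : ∀ p M → 0ℚ ≤ℚ peak∷ p M
  peak∷-nonNeg p M = ℚP.≤-trans (peak-nonNeg (suc p) M) (peak≤peak∷ p M)

  peak∷≤peak∷-∷ : ∀ p f M → Nonzero f → peak∷ (suc p) M ≤ℚ peak∷ p (f ∷ M)
  peak∷≤peak∷-∷ p f M f≢0 = subst (_≤ℚ peak∷ p (f ∷ M)) (peak-∷ (suc p) M f≢0) (peak≤peak∷ p (f ∷ M))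

  ∷-bounds : ∀ {d p K m c} → Nonzero d → suc (weight K) ≤ m × peak∷ p K ≤ℚ c →
             weight (d ∷ K) ≤ m × peak p (d ∷ K) ≤ℚ c
  ∷-bounds one≢0 bounds = bounds
  ∷-bounds neg≢0 bounds = bounds

  peak∷-2+ : ∀ p f K M → Nonzero f → weight K ≤ weight M →
             peak (3 ℕ.+ p) K ≤ℚ peak∷ p (f ∷ M) → peak∷ (2 ℕ.+ p) K ≤ℚ peak∷ p (f ∷ M)
  peak∷-2+ p f K M f≢0 wK≤wM c = ℚP.⊔-lub (ℚP.p≤q⇒p≤q⊔r (peak (suc p) (f ∷ M)) (begin
    costAt (2 ℕ.+ p) (suc (weight K))  ≤⟨ costAt-2+≤costAt-1+ p (suc (weight K)) ⟩
    costAt p (2 ℕ.+ weight K)          ≤⟨ costAt-mono-≤ (ℕP.≤-refl {p}) (s≤s (s≤s wK≤wM)) ⟩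
    costAt p (2 ℕ.+ weight M)          ≡⟨ cong (λ m → costAt p (suc m)) (sym (weight-∷ M f≢0)) ⟩
    costAt p (suc (weight (f ∷ M)))    ∎)) c
    where open ℚP.≤-Reasoning

  mutual
    NAF-optimal : ∀ p M {K} → NAF K → value K ≡ value M → K ≼[ p ] M
    NAF-optimal p [] {K} nK h = ℕP.≤-reflexive (weight-of-zero K h) , ℚP.≤-reflexive (peak-of-zero p K h)
    NAF-optimal p (d ∷ M) {[]} nK h = z≤n , peak-nonNeg p (d ∷ M)
    NAF-optimal p (d ∷ M) {e ∷ K} nK h with split e d K M h
    ... | same refl hK = ≼-∷ e p K M (NAF-optimal (suc p) M (NAF-tail nK) hK)
    ... | opposite e~d hM = NAF-opposite p M e~d nK hM

    NAF-opposite : ∀ p {d e K} M → Opposite e d → NAF (e ∷ K) → value M ≡ dval e ℤ.+ value K →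
                   e ∷ K ≼[ p ] d ∷ M
    NAF-opposite p M () (0∷ _) hM
    NAF-opposite p M e~d [ e≢0 ] hM =
      ∷-≼-∷ {K = []} {M} e≢0 (opposite-nonzeroʳ e~d) z≤n (peak∷-nonNeg p M)
    NAF-opposite p {e = e} {zer ∷ K} M e~d (e≢0 ∷0∷ nK) hM =
      let wK≤wM , c = NAF-halving p M e≢0 nK (trans hM (cong (ℤ._+_ (dval e)) (ℤP.+-identityˡ _)))
      in  ∷-≼-∷ {K = zer ∷ K} {M} e≢0 (opposite-nonzeroʳ e~d) wK≤wM c

    -- M represents 2v + e and K is a non-adjacent form of v.
    NAF-halving : ∀ p {e K} M → Nonzero e → NAF K → value M ≡ value (e ∷ K) →
                  weight K ≤ weight M × peak (2 ℕ.+ p) K ≤ℚ peak∷ p M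
    NAF-halving p {e} {K} [] e≢0 nK h = ⊥-elim (weight-∷≢0 K e≢0 (weight-of-zero (e ∷ K) (sym h)))
    NAF-halving p {e} {K} (f ∷ M) e≢0 nK h with split e f K M (sym h)
    ... | same refl hK =
      let wK≤wM , c = NAF-optimal (2 ℕ.+ p) M nK hK
      in  ℕP.≤-trans wK≤wM (weight≤weight-∷ e M) ,
          ℚP.≤-trans c (ℚP.≤-trans (peak≤peak∷ (suc p) M) (peak∷≤peak∷-∷ p e M e≢0))
    ... | opposite e~f hM = NAF-halving-opposite p M e≢0 (opposite-nonzeroʳ e~f) nK hM

    NAF-halving-opposite : ∀ p {e f K} M → Nonzero e → Nonzero f → NAF K → value M ≡ dval e ℤ.+ value K →
                           weight K ≤ weight (f ∷ M) × peak (2 ℕ.+ p) K ≤ℚ peak∷ p (f ∷ M)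
    NAF-halving-opposite p {f = f} M e≢0 f≢0 [] hM = z≤n , peak∷-nonNeg p (f ∷ M)
    NAF-halving-opposite p {e} {f} M e≢0 f≢0 (0∷ nK) hM =
      let wK≤wM , c = NAF-halving (suc p) M e≢0 nK (trans hM (cong (ℤ._+_ (dval e)) (ℤP.+-identityˡ _)))
      in  ℕP.≤-trans wK≤wM (weight≤weight-∷ f M) , ℚP.≤-trans c (peak∷≤peak∷-∷ p f M f≢0)
    NAF-halving-opposite p M e≢0 f≢0 [ g≢0 ] hM =
      ∷-bounds g≢0 (NAF-halving-∷ p M e≢0 f≢0 g≢0 [ g≢0 ] hM)
    NAF-halving-opposite p M e≢0 f≢0 (g≢0 ∷0∷ nK) hM =
      ∷-bounds g≢0 (NAF-halving-∷ p M e≢0 f≢0 g≢0 (g≢0 ∷0∷ nK) hM)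

    NAF-halving-∷ : ∀ p {e f g K} M → Nonzero e → Nonzero f → Nonzero g → NAF (g ∷ K) →
                    value M ≡ dval e ℤ.+ value (g ∷ K) →
                    suc (weight K) ≤ weight (f ∷ M) × peak∷ (2 ℕ.+ p) K ≤ℚ peak∷ p (f ∷ M)
    NAF-halving-∷ p M e≢0 f≢0 g≢0 nK hM with nonzero-cases e≢0 g≢0
    NAF-halving-∷ p {f = f} {K = K} M e≢0 f≢0 g≢0 nK hM | inj₂ e~g =
      let wK≤wM , c = NAF-optimal (2 ℕ.+ p) M (0∷ NAF-tail nK)
                        (sym (trans hM (opposite-cancel e~g (+ 2 ℤ.* value K))))
      in  subst (suc (weight K) ≤_) (sym (weight-∷ M f≢0)) (s≤s wK≤wM) ,
          peak∷-2+ p f K M f≢0 wK≤wM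
            (ℚP.≤-trans c (ℚP.≤-trans (peak≤peak∷ (suc p) M) (peak∷≤peak∷-∷ p f M f≢0)))
    NAF-halving-∷ p {e} M e≢0 f≢0 g≢0 [ _ ] hM | inj₁ refl =
      NAF-halving-double p M e≢0 f≢0 [] (trans hM (double-digit (dval e) (+ 0)))
    NAF-halving-∷ p {e} {K = zer ∷ K} M e≢0 f≢0 g≢0 (_ ∷0∷ nK) hM | inj₁ refl =
      NAF-halving-double p M e≢0 f≢0 nK
        (trans hM (trans (double-digit (dval e) (value (zer ∷ K)))
                         (cong (λ x → + 0 ℤ.+ + 2 ℤ.* (dval e ℤ.+ x)) (ℤP.+-identityˡ _))))

    NAF-halving-double : ∀ p {e f K} M → Nonzero e → Nonzero f → NAF K → value M ≡ value (zer ∷ e ∷ K) →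
                         suc (weight K) ≤ weight (f ∷ M) × peak∷ (2 ℕ.+ p) (zer ∷ K) ≤ℚ peak∷ p (f ∷ M)
    NAF-halving-double p {e} {K = K} [] e≢0 f≢0 nK hM =
      ⊥-elim (weight-∷≢0 K e≢0 (weight-of-zero (zer ∷ e ∷ K) (sym hM)))
    NAF-halving-double p {e} {f} {K} (h ∷ M) e≢0 f≢0 nK hM with split zer h (e ∷ K) M (sym hM)
    ... | same refl hK =
      let wK≤wM , c = NAF-halving (2 ℕ.+ p) M e≢0 nK (sym hK)
      in  subst (suc (weight K) ≤_) (sym (weight-∷ (zer ∷ M) f≢0)) (s≤s wK≤wM) ,
          peak∷-2+ p f (zer ∷ K) (zer ∷ M) f≢0 wK≤wM
            (ℚP.≤-trans c (peak∷-2+ p f M (zer ∷ M) f≢0 ℕP.≤-refl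
              (ℚP.≤-trans (peak≤peak∷ (suc p) (zer ∷ M)) (peak∷≤peak∷-∷ p f (zer ∷ M) f≢0))))

  -- The time model in closed form

  step : ℚ → ℕ → Digit → ℚ
  step t p zer = t
  step t p d   = (t ⊔ ℕtoℚ p * D) ℚ.+ absQ d * A

  run : ℚ → ℕ → List Digit → ℚ
  run t p []      = t
  run t p (d ∷ L) = run (step t p d) (suc p) L

  run-take-suc : ∀ t p K j → run t p (take (suc j) K) ≡ step (run t p (take j K)) (p + j) (dig K j)
  run-take-suc t p []      zero    = refl
  run-take-suc t p []      (suc j) = refl
  run-take-suc t p (d ∷ K) zero    = cong (λ q → step t q d) (sym (ℕP.+-identityʳ p))
  run-take-suc t p (d ∷ K) (suc j) = trans (run-take-suc (step t p d) (suc p) K j)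
    (cong (λ q → step (run (step t p d) (suc p) (take j K)) q (dig K j)) (sym (ℕP.+-suc p j)))

  mutual
    run-closed : ∀ {t} p L → 0ℚ ≤ℚ t → run t p L ≡ (t ℚ.+ ℕtoℚ (weight L) * A) ⊔ peak p L
    run-closed {t} p [] 0≤t = sym (begin
      (t ℚ.+ ℕtoℚ 0 * A) ⊔ 0ℚ ≡⟨ cong (λ x → (t ℚ.+ x) ⊔ 0ℚ) (ℚP.*-zeroˡ A) ⟩
      (t ℚ.+ 0ℚ) ⊔ 0ℚ         ≡⟨ cong (_⊔ 0ℚ) (ℚP.+-identityʳ t) ⟩
      t ⊔ 0ℚ                  ≡⟨ ℚP.p≥q⇒p⊔q≡p 0≤t ⟩
      t                       ∎)
      where open ≡-Reasoning
    run-closed p (zer ∷ L) 0≤t = run-closed (suc p) L 0≤t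
    run-closed p (one ∷ L) 0≤t = run-closed-∷ p L 0≤t
    run-closed p (neg ∷ L) 0≤t = run-closed-∷ p L 0≤t

    run-closed-∷ : ∀ {t} p L → 0ℚ ≤ℚ t →
                   run ((t ⊔ ℕtoℚ p * D) ℚ.+ 1ℚ * A) (suc p) L ≡
                   (t ℚ.+ ℕtoℚ (suc (weight L)) * A) ⊔ peak∷ p L
    run-closed-∷ {t} p L 0≤t = begin
      run t′ (suc p) L                               ≡⟨ run-closed (suc p) L 0≤t′ ⟩
      (t′ ℚ.+ ℕtoℚ w * A) ⊔ peak (suc p) L           ≡⟨ cong (_⊔ peak (suc p) L) t′+wA≡ ⟩
      ((t ℚ.+ w′A) ⊔ costAt p (suc w)) ⊔ peak (suc p) L ≡⟨ ℚP.⊔-assoc (t ℚ.+ w′A) (costAt p (suc w)) (peak (suc p) L) ⟩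
      (t ℚ.+ w′A) ⊔ peak∷ p L                        ∎
      where
      open ≡-Reasoning
      w = weight L
      w′A = ℕtoℚ (suc w) * A
      pD = ℕtoℚ p * D
      t′ = (t ⊔ pD) ℚ.+ 1ℚ * A
      0≤t′ : 0ℚ ≤ℚ t′
      0≤t′ = ℚP.+-mono-≤ (ℚP.≤-trans 0≤t (ℚP.p≤p⊔q t pD)) (subst (0ℚ ≤ℚ_) (sym (ℚP.*-identityˡ A)) 0≤A)
      regroup : ∀ x n a → (x ℚ.+ 1ℚ * a) ℚ.+ n * a ≡ x ℚ.+ (1ℚ ℚ.+ n) * a
      regroup = solve 3 (λ x n a → (x :+ con 1ℚ :* a) :+ n :* a := x :+ (con 1ℚ :+ n) :* a) refl
      t′+wA≡ : t′ ℚ.+ ℕtoℚ w * A ≡ (t ℚ.+ w′A) ⊔ costAt p (suc w)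
      t′+wA≡ = begin
        t′ ℚ.+ ℕtoℚ w * A                  ≡⟨ regroup (t ⊔ pD) (ℕtoℚ w) A ⟩
        (t ⊔ pD) ℚ.+ (1ℚ ℚ.+ ℕtoℚ w) * A   ≡⟨ cong (λ x → (t ⊔ pD) ℚ.+ x * A) (sym (ℕtoℚ-suc w)) ⟩
        (t ⊔ pD) ℚ.+ w′A                   ≡⟨ ℚP.mono-≤-distrib-⊔ (ℚP.+-monoˡ-≤ w′A) t pD ⟩
        (t ℚ.+ w′A) ⊔ costAt p (suc w)     ∎

  T-at-lowest : ∀ ℓ {s} K → Nonzero s → T D A (zeros ℓ ++ s ∷ K) ℓ ≡ ℕtoℚ ℓ * D ℚ.+ (absQ s ℚ.- 1ℚ) * A
  T-at-lowest zero    K one≢0 = refl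
  T-at-lowest zero    K neg≢0 = refl
  T-at-lowest (suc ℓ) {s} K s≢0 with dig (zeros (suc ℓ) ++ s ∷ K) (suc ℓ) | dig-zeros-≡ (suc ℓ) s K
  T-at-lowest (suc ℓ) K one≢0 | .one | refl rewrite lowerZero-zeros {suc ℓ} (one ∷ K) ℕP.≤-refl = refl
  T-at-lowest (suc ℓ) K neg≢0 | .neg | refl rewrite lowerZero-zeros {suc ℓ} (neg ∷ K) ℕP.≤-refl = refl

  no-addition : ∀ x {s} → Nonzero s → x ℚ.+ (absQ s ℚ.- 1ℚ) * A ≡ x
  no-addition x one≢0 = trans (cong (x ℚ.+_) (ℚP.*-zeroˡ A)) (ℚP.+-identityʳ x)
  no-addition x neg≢0 = trans (cong (x ℚ.+_) (ℚP.*-zeroˡ A)) (ℚP.+-identityʳ x)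

  T-above-lowest : ∀ ℓ {s} K → Nonzero s → ∀ i →
                   T D A (zeros ℓ ++ s ∷ K) (suc (ℓ + i)) ≡ step (T D A (zeros ℓ ++ s ∷ K) (ℓ + i)) (suc (ℓ + i)) (dig K i)
  T-above-lowest ℓ {s} K s≢0 i rewrite sym (dig-zeros-> ℓ s K i) with dig (zeros ℓ ++ s ∷ K) (suc (ℓ + i))
  ... | zer = refl
  ... | one rewrite lowerZero-> ℓ K s≢0 i = refl
  ... | neg rewrite lowerZero-> ℓ K s≢0 i = refl

  T-run : ∀ ℓ {s} K → Nonzero s → ∀ j →
          T D A (zeros ℓ ++ s ∷ K) (ℓ + j) ≡ run (ℕtoℚ ℓ * D) (suc ℓ) (take j K)
  T-run ℓ K s≢0 zero =
    trans (cong (T D A _) (ℕP.+-identityʳ ℓ)) (trans (T-at-lowest ℓ K s≢0) (no-addition _ s≢0))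
  T-run ℓ K s≢0 (suc j) = begin
    T D A N (ℓ + suc j)
      ≡⟨ cong (T D A N) (ℕP.+-suc ℓ j) ⟩
    T D A N (suc (ℓ + j))
      ≡⟨ T-above-lowest ℓ K s≢0 j ⟩
    step (T D A N (ℓ + j)) (suc (ℓ + j)) (dig K j)
      ≡⟨ cong (λ t → step t (suc (ℓ + j)) (dig K j)) (T-run ℓ K s≢0 j) ⟩
    step (run ℓD (suc ℓ) (take j K)) (suc ℓ + j) (dig K j)
      ≡⟨ run-take-suc ℓD (suc ℓ) K j ⟨
    run ℓD (suc ℓ) (take (suc j) K) ∎
    where
    open ≡-Reasoning
    N = zeros ℓ ++ _ ∷ K
    ℓD = ℕtoℚ ℓ * D

  T-closed-form : ∀ ℓ {s} K → Nonzero s →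
                  T D A (zeros ℓ ++ s ∷ K) (ℓ + length K) ≡ costAt ℓ (weight K) ⊔ peak (suc ℓ) K
  T-closed-form ℓ K s≢0 = begin
    T D A (zeros ℓ ++ _ ∷ K) (ℓ + length K) ≡⟨ T-run ℓ K s≢0 (length K) ⟩
    run ℓD (suc ℓ) (take (length K) K)      ≡⟨ cong (run ℓD (suc ℓ)) (ListP.take-all (length K) K ℕP.≤-refl) ⟩
    run ℓD (suc ℓ) K                        ≡⟨ run-closed (suc ℓ) K 0≤ℓD ⟩
    costAt ℓ (weight K) ⊔ peak (suc ℓ) K    ∎
    where
    open ≡-Reasoning
    ℓD = ℕtoℚ ℓ * D
    0≤ℓD : 0ℚ ≤ℚ ℓD
    0≤ℓD = subst (_≤ℚ ℓD) (ℚP.*-zeroˡ D) (ℚP.*-monoʳ-≤-nonNeg D (ℕtoℚ-nonNeg ℓ))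

  zer∷-≼ : ∀ d p W → zer ∷ W ≼[ p ] d ∷ W
  zer∷-≼ zer p W = ≼-refl {p} {zer ∷ W}
  zer∷-≼ one p W = ℕP.n≤1+n _ , peak≤peak∷ p W
  zer∷-≼ neg p W = ℕP.n≤1+n _ , peak≤peak∷ p W

  ∷zer-≼-zer∷ : ∀ {d} p W → Nonzero d → d ∷ zer ∷ W ≼[ p ] zer ∷ d ∷ W
  ∷zer-≼-zer∷ p W one≢0 = ℕP.≤-refl , ℚP.⊔-monoˡ-≤ _ (costAt-mono-≤ (ℕP.n≤1+n p) (ℕP.≤-refl {suc (weight W)}))
  ∷zer-≼-zer∷ p W neg≢0 = ℕP.≤-refl , ℚP.⊔-monoˡ-≤ _ (costAt-mono-≤ (ℕP.n≤1+n p) (ℕP.≤-refl {suc (weight W)}))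

  -- With v = 1 + 2 (value κ), these are the non-adjacent forms of 2v + 1 and of 2v.
  up down : List Digit → List Digit
  up   κ = neg ∷ zer ∷ carry (κ ++ zer ∷ [])
  down κ = zer ∷ scan one (κ ++ zer ∷ [])

  -- When rounding up does not pay it costs exactly one more nonzero digit, which the induction needs.
  RoundUp : Bool → ℕ → List Digit → Set
  RoundUp true  p κ = up κ ≼[ p ] down κ
  RoundUp false p κ = weight (up κ) ≡ suc (weight (down κ)) × peak p (down κ) ≤ℚ peak p (up κ)

  round-up-loses : ∀ p Z → peak p (zer ∷ one ∷ zer ∷ Z) ≤ℚ peak p (neg ∷ zer ∷ one ∷ Z)
  round-up-loses p Z = ℚP.⊔-lub
    (ℚP.p≤q⇒p≤q⊔r (peak (suc p) (zer ∷ one ∷ Z)) (costAt-1+≤costAt-1+ p (suc (weight Z))))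
    (ℚP.p≤q⇒p≤r⊔q (costAt p (2 + weight Z)) (ℚP.p≤q⊔p (costAt (2 + p) (suc (weight Z))) (peak (3 + p) Z)))

  round-up-comparison : ∀ p κ → Bits κ → RoundUp (tail₁ (one ∷ κ ++ zer ∷ zer ∷ [])) p κ
  round-up-comparison p []                        []                   = refl , round-up-loses p []
  round-up-comparison p (zer ∷ [])                (bit0 ∷ [])          = refl , round-up-loses p (zer ∷ [])
  round-up-comparison p (zer ∷ zer ∷ κ)           (bit0 ∷ bit0 ∷ _)    = refl , round-up-loses p (scan zer (κ ++ zer ∷ []))
  round-up-comparison p (one ∷ κ)                 (bit1 ∷ _)           = ∷zer-≼-zer∷ p (zer ∷ carry (κ ++ zer ∷ [])) neg≢0
  round-up-comparison p (zer ∷ neg ∷ κ)           (bit0 ∷ () ∷ _)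
  round-up-comparison p (zer ∷ one ∷ κ)           (bit0 ∷ bit1 ∷ bκ)
    with tail₁ (one ∷ κ ++ zer ∷ zer ∷ []) | round-up-comparison (2 + p) κ bκ
  ... | true  | w≤ , c  = s≤s w≤ , ℚP.⊔-mono-≤ (costAt-mono-≤ (ℕP.n≤1+n p) (s≤s w≤)) c
  ... | false | w≡ , c  = cong suc w≡ , ℚP.⊔-lub
    (ℚP.p≤q⇒p≤q⊔r (peak (2 + p) (up κ))
      (subst (λ m → costAt (suc p) (suc (weight (down κ))) ≤ℚ costAt p (suc m)) (sym w≡)
             (costAt-1+≤costAt-1+ p (suc (weight (down κ))))))
    (ℚP.p≤q⇒p≤r⊔q (costAt p (suc (weight (up κ)))) c)

  data Choice (p : ℕ) (β : List Digit) : List Digit → Set where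
    keep  : naf β ≼[ p ] carry β → Choice p β (one ∷ naf β)
    round : carry β ≼[ p ] naf β → Choice p β (neg ∷ carry β)

  candidate-choice : ∀ p κ → Bits κ → Choice p (κ ++ zer ∷ []) (candidate (test₁ κ) (test₂ κ) (κ ++ zer ∷ []))
  candidate-choice p []                   []                 = keep (zer∷-≼ one p [])
  candidate-choice p (zer ∷ [])           (bit0 ∷ [])        = keep (zer∷-≼ one p (zer ∷ []))
  candidate-choice p (zer ∷ zer ∷ κ)      (bit0 ∷ bit0 ∷ _)  = keep (zer∷-≼ one p (scan zer (κ ++ zer ∷ [])))
  candidate-choice p (zer ∷ one ∷ κ)      (bit0 ∷ bit1 ∷ bκ)
    with tail₁ (one ∷ κ ++ zer ∷ zer ∷ []) | round-up-comparison p κ bκ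
  ... | true  | up≼down  = round up≼down
  ... | false | w≡ , c   = keep (subst (weight (down κ) ≤_) (sym w≡) (ℕP.n≤1+n _) , c)
  candidate-choice p (zer ∷ neg ∷ _)      (bit0 ∷ () ∷ _)
  candidate-choice p (one ∷ [])           (bit1 ∷ [])        = keep (∷zer-≼-zer∷ p [] one≢0)
  candidate-choice p (one ∷ one ∷ κ)      (bit1 ∷ bit1 ∷ _)  = round (zer∷-≼ neg p (zer ∷ carry (κ ++ zer ∷ [])))
  candidate-choice p (one ∷ zer ∷ [])     (bit1 ∷ bit0 ∷ []) = keep (∷zer-≼-zer∷ p (zer ∷ []) one≢0)
  candidate-choice p (one ∷ zer ∷ zer ∷ κ) (bit1 ∷ bit0 ∷ bit0 ∷ _) =
    keep (∷zer-≼-zer∷ p (scan zer (κ ++ zer ∷ [])) one≢0)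
  candidate-choice p (one ∷ zer ∷ one ∷ κ) (bit1 ∷ bit0 ∷ bit1 ∷ bκ)
    rewrite tail₂≡not-tail₁ (bit1 ∷ bκ)
    with tail₁ (one ∷ κ ++ zer ∷ zer ∷ []) | round-up-comparison (suc p) κ bκ
  ... | true  | w≤ , c = round (ℕP.≤-trans w≤ (ℕP.n≤1+n _) , ℚP.≤-trans c (peak≤peak∷ p (down κ)))
  ... | false | w≡ , c = keep (ℕP.≤-reflexive (sym w≡) , ℚP.⊔-lub
    (ℚP.p≤q⇒p≤q⊔r _ (costAt-mono-≤ (ℕP.n≤1+n p) (ℕP.≤-reflexive (sym w≡)))) c)
  candidate-choice p (one ∷ zer ∷ neg ∷ _) (bit1 ∷ bit0 ∷ () ∷ _)

  choice-value : ∀ {p β L} → Bits β → Choice p β L → value L ≡ value (one ∷ β)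
  choice-value bβ (keep _)  = cong (λ v → + 1 ℤ.+ + 2 ℤ.* v) (naf-value bβ)
  choice-value {β = β} bβ (round _) = trans (cong (λ v → -[1+ 0 ] ℤ.+ + 2 ℤ.* v) (carry-value bβ)) (lemma (value β))
    where lemma : ∀ v → -[1+ 0 ] ℤ.+ + 2 ℤ.* (+ 1 ℤ.+ v) ≡ + 1 ℤ.+ + 2 ℤ.* v
          lemma = solve-∀

  choice-nonzero : ∀ {p β s K} → Choice p β (s ∷ K) → Nonzero s
  choice-nonzero (keep _)  = one≢0
  choice-nonzero (round _) = neg≢0

  choice-≼ : ∀ {p β s K} → Choice p β (s ∷ K) → K ≼[ p ] naf β × K ≼[ p ] carry β
  choice-≼ {p} {β} (keep naf≼carry)  = ≼-refl {p} {naf β} , naf≼carry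
  choice-≼ {p} {β} (round carry≼naf) = carry≼naf , ≼-refl {p} {carry β}

  naf-or-carry-≼ : ∀ p {β} d M → Bits β → value (d ∷ M) ≡ value (one ∷ β) → naf β ≼[ p ] M ⊎ carry β ≼[ p ] M
  naf-or-carry-≼ p {β} d M bβ h with split d one M β h
  ... | same refl M≡β       = inj₁ (NAF-optimal p M (naf-NAF bβ) (trans (naf-value bβ) (sym M≡β)))
  ... | opposite neg-one β≡ = inj₂ (NAF-optimal p M (carry-NAF bβ)
                                      (trans (carry-value bβ) (trans (cong (ℤ._+_ (+ 1)) β≡) (lemma (value M)))))
    where lemma : ∀ v → + 1 ℤ.+ (-[1+ 0 ] ℤ.+ v) ≡ v
          lemma = solve-∀

  choice-optimal : ∀ {p β s K} d M → Bits β → Choice p β (s ∷ K) → value (d ∷ M) ≡ value (one ∷ β) → K ≼[ p ] M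
  choice-optimal {p} d M bβ choice h =
    let K≼naf , K≼carry = choice-≼ choice
    in  [ ≼-trans K≼naf , ≼-trans K≼carry ]′ (naf-or-carry-≼ p d M bβ h)

  T-vec : ∀ {λ′ ℓ s K} (V : Vec Digit (suc (suc λ′))) → toList V ≡ zeros ℓ ++ s ∷ K → Nonzero s →
          T D A (toList V) (suc λ′) ≡ costAt ℓ (weight K) ⊔ peak (suc ℓ) K
  T-vec {λ′} {ℓ} {s} {K} V V≡ s≢0 = trans (cong₂ (T D A) V≡ (sym ℓ+K≡)) (T-closed-form ℓ K s≢0)
    where
    open ≡-Reasoning
    ℓ+K≡ : ℓ + length K ≡ suc λ′
    ℓ+K≡ = ℕP.suc-injective (begin
      suc (ℓ + length K)                  ≡⟨ ℕP.+-suc ℓ (length K) ⟨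
      ℓ + suc (length K)                  ≡⟨ cong (_+ suc (length K)) (ListP.length-replicate ℓ) ⟨
      length (zeros ℓ) + length (s ∷ K)   ≡⟨ ListP.length-++ (zeros ℓ) ⟨
      length (zeros ℓ ++ s ∷ K)           ≡⟨ cong length V≡ ⟨
      length (toList V)                   ≡⟨ VecP.length-toList V ⟩
      suc (suc λ′)                        ∎)

  chosen-optimal : ∀ {λ′ ℓ κ L} (V : Vec Digit (suc (suc λ′))) → Bits κ → toList V ≡ zeros ℓ ++ L →
                   Choice (suc ℓ) (κ ++ zer ∷ []) L →
                   value (toList V) ≡ value (zeros ℓ ++ one ∷ κ) ×
                   ((M : Vec Digit (suc (suc λ′))) → value (toList M) ≡ value (zeros ℓ ++ one ∷ κ) →
                    T D A (toList V) (suc λ′) ≤ℚ T D A (toList M) (suc λ′))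
  chosen-optimal {L = []} V bκ V≡ ()
  chosen-optimal {λ′} {ℓ} {κ} {s ∷ K} V bκ V≡ choice = value-≡ , faster
    where
    bβ = ++-zer-Bits bκ
    1β≡1κ : value (one ∷ κ ++ zer ∷ []) ≡ value (one ∷ κ)
    1β≡1κ = cong (λ v → + 1 ℤ.+ + 2 ℤ.* v) (value-++-zer κ)
    value-≡ : value (toList V) ≡ value (zeros ℓ ++ one ∷ κ)
    value-≡ = trans (cong value V≡) (value-zeros-++ ℓ (trans (choice-value bβ choice) 1β≡1κ))
    faster : (M : Vec Digit (suc (suc λ′))) → value (toList M) ≡ value (zeros ℓ ++ one ∷ κ) →
             T D A (toList V) (suc λ′) ≤ℚ T D A (toList M) (suc λ′)
    faster M hM =
      let d , M′ , M≡ , d≢0 , dM′≡ = trailing-zeros ℓ (toList M) κ hM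
          w , c = choice-optimal d M′ bβ choice (trans dM′≡ (sym 1β≡1κ))
      in  subst₂ _≤ℚ_ (sym (T-vec V V≡ (choice-nonzero choice))) (sym (T-vec M M≡ d≢0))
                 (ℚP.⊔-mono-≤ (costAt-mono-≤ (ℕP.≤-refl {ℓ}) w) c)

  algorithm2-optimal : ∀ {λ′} (NB : Vec Digit (suc λ′)) → All IsBit NB → value (toList NB) ≢ + 0 →
                       value (toList (algorithm2 NB)) ≡ value (toList NB) ×
                       ((M : Vec Digit (suc (suc λ′))) → value (toList M) ≡ value (toList NB) →
                        T D A (toList (algorithm2 NB)) (suc λ′) ≤ℚ T D A (toList M) (suc λ′))
  algorithm2-optimal NB bits v≢0 =
    let ℓ , κ , NB≡ , bκ = lowest-one (VecAllP.toList⁺ bits) v≢0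
        value-≡ , faster = chosen-optimal (algorithm2 NB) bκ (algorithm2-output NB ℓ κ NB≡ bκ)
                                          (candidate-choice (suc ℓ) κ bκ)
    in  trans value-≡ (cong value (sym NB≡)) , λ M hM → faster M (trans hM (cong value NB≡))

theorem4 : (D A : ℚ) → 0ℚ < D → (+ 2 Data.Rational./ 1) * D ≤ℚ A →
           (n : ℕ) → 1 ≤ n →
           (λ′ : ℕ) (NB : Vec Digit (suc λ′)) →
           All IsBit NB → last NB ≡ one → IsCanonicalRep NB n →
           IsCanonicalRep (algorithm2 NB) n
           × ((M : Vec Digit (suc (suc λ′))) → IsCanonicalRep M n →
              T D A (toList (algorithm2 NB)) (suc λ′) ≤ℚ T D A (toList M) (suc λ′))
theorem4 D A 0<D 2*D≤A n 1≤n λ′ NB bits _ NB≡n =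
  let value-≡ , faster = Cost.algorithm2-optimal D A (ℚP.<⇒≤ 0<D) D+D≤A NB bits NB≢0
  in  trans value-≡ NB≡n , λ M M≡n → faster M (trans M≡n (sym NB≡n))
  where
  D+D≤A : D ℚ.+ D ≤ℚ A
  D+D≤A = subst (_≤ℚ A) (trans (ℚP.*-distribʳ-+ D 1ℚ 1ℚ) (cong₂ ℚ._+_ (ℚP.*-identityˡ D) (ℚP.*-identityˡ D)))
                2*D≤A
  NB≢0 : value (toList NB) ≢ + 0
  NB≢0 NB≡0 = ℕP.<⇒≢ 1≤n (sym (ℤP.+-injective (trans (sym NB≡n) NB≡0)))
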